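{- Let $D=(V,A)$ be a bipartite DAG with a Hamiltonian path $P=(v_1,\ldots,v_n)$. Define $w:V\to\mathbb{Z}_+$ by $w(v_1)=\deg(v_1)$ and $w(v_i)=\max\{w(v_{i-1})+1,\deg(v_i)\}$ for $i\in\{2,\ldots,n\}$, and define $b:V\to\mathbb{Z}_+$ by $b(v)=w(v)-\deg(v)$. Then $\mathrm{din}(D)=|A|+\alpha(D,b)$.
   Context: A DAG is a finite directed acyclic graph without loops or multiple arcs; it is bipartite if its vertex set can be partitioned into two independent sets (sets of pairwise nonadjacent vertices, where adjacency ignores orientation). A Hamiltonian path is a directed path containing all vertices. $\deg(v)$ is the number of vertices adjacent to $v$. $\alpha(D,b)$ is the maximum of $\sum_{v\in S}b(v)$ over all independent sets $S$ of $D$. A directed intersection representation of $D$ is a pair $(U,\varphi)$, $U$ finite, $\varphi(v)\subseteq U$, such that for all $u,v\in V$: $(u,v)\in A$ iff $\varphi(u)\cap\varphi(v)\neq\emptyset$ and $|\varphi(u)|<|\varphi(v)|$; $\mathrm{din}(D)$ is the minimum $|U|$ of such a representation. -}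

module Defs where

open import Data.Nat using (ℕ; zero; suc; _+_; _∸_; _⊔_; _≤_; _<_)
open import Data.Bool using (Bool; true; false; _∨_; if_then_else_)
open import Data.Fin using (Fin; zero; suc; toℕ)
open import Data.Fin.Subset using (Subset; _∈_; _∉_; _∩_; ∣_∣)
open import Data.Fin.Permutation using (Permutation′; _⟨$⟩ʳ_; _⟨$⟩ˡ_)
open import Data.List using (List; map; allFin)
open import Data.Nat.ListAction using (sum)
open import Data.Product using (Σ; _×_; ∃; ∃-syntax)
open import Data.Sum using (_⊎_)
open import Relation.Binary.PropositionalEquality using (_≡_; _≢_)
open import Relation.Nullary using (¬_)

-- A digraph on vertex set Fin n, given by its arc relation (so no multiple arcs).
Digraph : ℕ → Set
Digraph n = Fin n → Fin n → Bool

data Walk {n : ℕ} (A : Digraph n) : Fin n → Fin n → Set where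
  arc  : ∀ {u v} → A u v ≡ true → Walk A u v
  cons : ∀ {u v w} → A u v ≡ true → Walk A v w → Walk A u w

IsDAG : ∀ {n} → Digraph n → Set
IsDAG {n} A = (v : Fin n) → ¬ Walk A v v

Adj : ∀ {n} → Digraph n → Fin n → Fin n → Bool
Adj A u v = A u v ∨ A v u

IsIndependent : ∀ {n} → Digraph n → Subset n → Set
IsIndependent {n} A S = (u v : Fin n) → u ∈ S → v ∈ S → Adj A u v ≡ false

IsBipartite : ∀ {n} → Digraph n → Set
IsBipartite {n} A = Σ (Subset n) λ X → Σ (Subset n) λ Y →
  IsIndependent A X × IsIndependent A Y ×
  ((v : Fin n) → v ∈ X ⊎ v ∈ Y) × ((v : Fin n) → v ∈ X → v ∉ Y)

-- Hamiltonian path: v_i = π i (i = 0..n-1), with arcs v_i → v_{i+1}.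
IsHamPath : ∀ {n} → Digraph n → Permutation′ n → Set
IsHamPath {n} A π = (i j : Fin n) → toℕ j ≡ suc (toℕ i) → A (π ⟨$⟩ʳ i) (π ⟨$⟩ʳ j) ≡ true

count : ∀ {n} → (Fin n → Bool) → ℕ
count {n} f = sum (map (λ v → if f v then 1 else 0) (allFin n))

numArcs : ∀ {n} → Digraph n → ℕ
numArcs {n} A = sum (map (λ u → count (A u)) (allFin n))

deg : ∀ {n} → Digraph n → Fin n → ℕ
deg A v = count (λ u → Adj A u v)

-- wGo m d i: with d the degree sequence along the path,
-- wGo 0 d zero = d 0, and wGo 0 d (i+1) = max (wGo 0 d i + 1) (d (i+1)).
wGo : ∀ {n} → ℕ → (Fin n → ℕ) → Fin n → ℕ
wGo m d zero    = m ⊔ d zero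
wGo m d (suc i) = wGo (suc (m ⊔ d zero)) (λ j → d (suc j)) i

wIdx : ∀ {n} → Digraph n → Permutation′ n → Fin n → ℕ
wIdx A π = wGo 0 (λ i → deg A (π ⟨$⟩ʳ i))

w : ∀ {n} → Digraph n → Permutation′ n → Fin n → ℕ
w A π v = wIdx A π (π ⟨$⟩ˡ v)

b : ∀ {n} → Digraph n → Permutation′ n → Fin n → ℕ
b A π v = w A π v ∸ deg A v

weight : ∀ {n} → (Fin n → ℕ) → Subset n → ℕ
weight {n} c S = sum (map (λ v → if Data.Vec.lookup S v then c v else 0) (allFin n))
  where import Data.Vec

IsAlpha : ∀ {n} → Digraph n → (Fin n → ℕ) → ℕ → Set
IsAlpha {n} A c a =
  (Σ (Subset n) λ S → IsIndependent A S × weight c S ≡ a) ×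
  ((S : Subset n) → IsIndependent A S → weight c S ≤ a)

IsDIR : ∀ {n} → Digraph n → (m : ℕ) → (Fin n → Subset m) → Set
IsDIR {n} A m φ = (u v : Fin n) →
  (A u v ≡ true → (∃[ x ] (x ∈ φ u × x ∈ φ v)) × ∣ φ u ∣ < ∣ φ v ∣) ×
  ((∃[ x ] (x ∈ φ u × x ∈ φ v)) × ∣ φ u ∣ < ∣ φ v ∣ → A u v ≡ true)

IsDin : ∀ {n} → Digraph n → ℕ → Set
IsDin {n} A k =
  (Σ (Fin n → Subset k) λ φ → IsDIR A k φ) ×
  ((m : ℕ) (φ : Fin n → Subset m) → IsDIR A m φ → k ≤ m)

module Submission where

-- In a directed intersection representation (U, φ) the sizes |φ v| strictly
-- increase along the Hamiltonian path, so they are pairwise distinct and any two vertices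
-- whose sets meet are adjacent. A bipartite digraph has no triangles, hence every element
-- of U lies in at most two sets, and in two only if they are the ends of an arc. Every arc
-- needs an element of its own, so |φ v| ≥ deg v, and then |φ v| ≥ w v, w being the least
-- function above deg that increases along the path. Given an independent set S, count each
-- element once for the vertex of S holding it or once for the arc outside S whose ends hold
-- it: |U| ≥ Σ_{v ∈ S} (deg v + b v) + #(arcs outside S) = |A| + b(S).
--
-- Egerváry's theorem for the bipartite graph underlying D gives a b-matching M
-- (a list of arcs in which each v occurs at most b v times) and a vertex cover C of b-weight
-- at most |M|, so S = V ∖ C is independent. Give every arc an element, every arc of M one
-- more, and every v another b v − deg_M v elements of its own. Then |φ v| = deg v + b v = w v
-- increases along arcs, and the |A| + Σ b − |M| ≤ |A| + b(S) elements, padded with unused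
-- ones to |A| + b(S), form a representation. Hence α(D, b) = b(S) and din(D) = |A| + b(S).

open import Defs

open import Data.Bool using (Bool; true; false; not; _∧_; _∨_; if_then_else_)
import Data.Bool.Properties as Bool
open import Data.Bool.Properties using (∨-comm; ∨-zeroʳ; ¬-not)
open import Data.Empty using (⊥; ⊥-elim)
open import Data.Fin using (Fin; zero; suc; toℕ; fromℕ<)
open import Data.Fin.Permutation using (Permutation′; _⟨$⟩ʳ_; _⟨$⟩ˡ_; inverseˡ; inverseʳ)
open import Data.Fin.Properties using (_≟_; any?; toℕ-fromℕ<; toℕ<n; toℕ-injective)
open import Data.Fin.Subset using (Subset; _∈_; ∣_∣)
open import Data.List using (List; []; _∷_; _++_; map; allFin; tabulate; length; cartesianProduct)
import Data.List as List
open import Data.List.Membership.Propositional using () renaming (_∈_ to _∈ₗ_)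
open import Data.List.Membership.Propositional.Properties
  using (∈-lookup; ∈-filter⁺; ∈-cartesianProduct⁺; ∈-allFin)
open import Data.List.Properties using (map-++; map-∘; length-++; length-map; length-replicate)
open import Data.List.Relation.Unary.All as All using (All; []; _∷_)
open import Data.List.Relation.Unary.All.Properties using (all-filter; concat⁺; map⁺; replicate⁺; ++⁺)
open import Data.List.Relation.Unary.Any as Any using (Any; here; there)
open import Data.List.Relation.Unary.Any.Properties as Any using (lookup-index; ++⁺ˡ)
open import Data.Nat using (ℕ; zero; suc; _+_; _∸_; _≤_; _<_; _≤?_; z≤n; s≤s; s≤s⁻¹)
open import Data.Nat.ListAction using () renaming (sum to sumˡ)
open import Data.Nat.ListAction.Properties using (sum-++)
open import Data.Nat.Properties hiding (_≟_)
open import Data.Product using (Σ; _×_; _,_; proj₁; proj₂; ∃-syntax)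
open import Data.Sum using (_⊎_; inj₁; inj₂; [_,_]′)
open import Data.Vec using (lookup; []; _∷_)
import Data.Vec as Vec
open import Data.Vec.Properties using ([]=⇒lookup; lookup⇒[]=; lookup∘tabulate)
open import Function using (_∘_; id; case_of_)
open import Relation.Binary using (tri<; tri≈; tri>)
open import Relation.Binary.PropositionalEquality
open import Relation.Nullary using (Dec; yes; no; does)
open import Relation.Nullary.Decidable using (dec-true)

open import Algebra.Properties.CommutativeMonoid.Sum +-0-commutativeMonoid
  using (sum; sum-syntax; ∑-distrib-+; ∑-comm; sum-cong-≗; sum-replicate-zero)
open import Algebra.Properties.CommutativeSemigroup +-commutativeSemigroup using (xy∙z≈xz∙y)

-- Finite sums

𝟙 : Bool → ℕ
𝟙 β = if β then 1 else 0

∑-mono-≤ : ∀ {n} {f g : Fin n → ℕ} → (∀ i → f i ≤ g i) → sum f ≤ sum g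
∑-mono-≤ {zero}  f≤g = z≤n
∑-mono-≤ {suc n} f≤g = +-mono-≤ (f≤g zero) (∑-mono-≤ (f≤g ∘ suc))

∑-zero : ∀ {n} (f : Fin n → ℕ) → (∀ i → f i ≡ 0) → sum f ≡ 0
∑-zero {n} f f≡0 = trans (sum-cong-≗ f≡0) (sum-replicate-zero n)

term≤∑ : ∀ {n} (f : Fin n → ℕ) i → f i ≤ sum f
term≤∑ f zero    = m≤m+n _ _
term≤∑ f (suc i) = ≤-trans (term≤∑ (f ∘ suc) i) (m≤n+m _ _)

∑²-distrib-+ : ∀ {m n} (f g : Fin m → Fin n → ℕ) →
               ∑[ i < m ] ∑[ j < n ] (f i j + g i j) ≡ ∑[ i < m ] ∑[ j < n ] f i j + ∑[ i < m ] ∑[ j < n ] g i j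
∑²-distrib-+ {m} {n} f g =
  trans (sum-cong-≗ λ i → ∑-distrib-+ (f i) (g i)) (∑-distrib-+ (λ i → ∑[ j < n ] f i j) (λ i → ∑[ j < n ] g i j))

∑-const-1 : ∀ n → ∑[ _ < n ] 1 ≡ n
∑-const-1 zero    = refl
∑-const-1 (suc n) = cong suc (∑-const-1 n)

∑-δ : ∀ {n} (p : Fin n) (f : Fin n → ℕ) → ∑[ t < n ] (if does (p ≟ t) then f t else 0) ≡ f p
∑-δ {suc n} zero f = trans (cong (f zero +_) (sum-replicate-zero n)) (+-identityʳ _)
∑-δ {suc n} (suc p) f = ∑-δ p (f ∘ suc)

∑-δ′ : ∀ {n} (p : Fin n) (f : Fin n → ℕ) → ∑[ t < n ] (if does (t ≟ p) then f t else 0) ≡ f p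
∑-δ′ p f = trans (sum-cong-≗ (λ t → cong (λ β → if β then f t else 0) (does-sym t))) (∑-δ p f)
  where
  does-sym : ∀ t → does (t ≟ p) ≡ does (p ≟ t)
  does-sym t with t ≟ p | p ≟ t
  ... | yes refl | yes _   = refl
  ... | yes refl | no p≢p  = ⊥-elim (p≢p refl)
  ... | no t≢t   | yes refl = ⊥-elim (t≢t refl)
  ... | no _     | no _    = refl

∑-if : ∀ {n} β (f : Fin n → ℕ) → ∑[ t < n ] (if β then f t else 0) ≡ (if β then sum f else 0)
∑-if {n} true  f = refl
∑-if {n} false f = sum-replicate-zero n

if-+ : ∀ β {x y} → (if β then x + y else 0) ≡ (if β then x else 0) + (if β then y else 0)
if-+ true  = refl
if-+ false = refl

if-mono : ∀ β {x y} → x ≤ y → (if β then x else 0) ≤ (if β then y else 0)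
if-mono true  x≤y = x≤y
if-mono false _   = z≤n

𝟙-false : ∀ {β} → (β ≡ true → ⊥) → 𝟙 β ≡ 0
𝟙-false {false} _    = refl
𝟙-false {true}  b≢tt = ⊥-elim (b≢tt refl)

𝟙≤ : ∀ {β k} → (β ≡ true → 1 ≤ k) → 𝟙 β ≤ k
𝟙≤ {false} _     = z≤n
𝟙≤ {true}  1≤k  = 1≤k refl

witness≤∑ : ∀ {n} (P : Fin n → Bool) {i} → P i ≡ true → 1 ≤ ∑[ j < n ] 𝟙 (P j)
witness≤∑ P {i} Pi = subst (_≤ _) (cong 𝟙 Pi) (term≤∑ (𝟙 ∘ P) i)

∑-single : ∀ {n} (f : Fin n → ℕ) j → (∀ i → i ≢ j → f i ≡ 0) → sum f ≡ f j
∑-single f j others = trans (sum-cong-≗ at-j) (∑-δ j f)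
  where
  at-j : ∀ i → f i ≡ (if does (j ≟ i) then f i else 0)
  at-j i with j ≟ i
  ... | yes _   = refl
  ... | no j≢i  = others i (j≢i ∘ sym)

∑𝟙≤1 : ∀ {n} (P : Fin n → Bool) → (∀ i j → P i ≡ true → P j ≡ true → i ≡ j) → ∑[ i < n ] 𝟙 (P i) ≤ 1
∑𝟙≤1 P unique with any? (λ i → P i Bool.≟ true)
... | yes (j , Pj) = begin
  ∑[ i < _ ] 𝟙 (P i) ≡⟨ ∑-single (𝟙 ∘ P) j (λ i i≢j → 𝟙-false λ Pi → i≢j (unique i j Pi Pj)) ⟩
  𝟙 (P j)            ≤⟨ 𝟙≤ (λ _ → ≤-refl) ⟩
  1                  ∎
  where
  open ≤-Reasoning
... | no none = ≤-trans (≤-reflexive (∑-zero _ λ i → 𝟙-false λ Pi → none (i , Pi))) z≤n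

∑∑𝟙≤1 : ∀ {n} (F : Fin n → Fin n → Bool) →
         (∀ {u v u′ v′} → F u v ≡ true → F u′ v′ ≡ true → u ≡ u′ × v ≡ v′) →
         ∑[ u < n ] ∑[ v < n ] 𝟙 (F u v) ≤ 1
∑∑𝟙≤1 F unique with any? (λ u → any? (λ v → F u v Bool.≟ true))
... | yes (u₀ , v₀ , F₀) = begin
  ∑[ u < _ ] ∑[ v < _ ] 𝟙 (F u v) ≡⟨ ∑-single _ u₀ other-rows ⟩
  ∑[ v < _ ] 𝟙 (F u₀ v)           ≤⟨ ∑𝟙≤1 (F u₀) same-row ⟩
  1                               ∎
  where
  open ≤-Reasoning
  other-rows : ∀ u → u ≢ u₀ → ∑[ v < _ ] 𝟙 (F u v) ≡ 0
  other-rows u u≢u₀ = ∑-zero (λ v → 𝟙 (F u v)) λ v → 𝟙-false λ Fuv → u≢u₀ (proj₁ (unique Fuv F₀))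
  same-row : ∀ v v′ → F u₀ v ≡ true → F u₀ v′ ≡ true → v ≡ v′
  same-row v v′ Fv Fv′ = trans (proj₂ (unique Fv F₀)) (sym (proj₂ (unique Fv′ F₀)))
... | no none = ≤-trans (≤-reflexive (∑-zero _ λ u → ∑-zero (λ v → 𝟙 (F u v)) λ v → 𝟙-false λ Fuv → none (u , v , Fuv)))
                        z≤n

list-sum-allFin : ∀ {n} (f : Fin n → ℕ) → sumˡ (map f (allFin n)) ≡ sum f
list-sum-allFin {n} f = go n f id
  where
  go : ∀ {A : Set} k (f : A → ℕ) (g : Fin k → A) → sumˡ (map f (tabulate g)) ≡ sum (f ∘ g)
  go zero    f g = refl
  go (suc k) f g = cong (f (g zero) +_) (go k f (g ∘ suc))

∧-true : ∀ {x y} → x ∧ y ≡ true → x ≡ true × y ≡ true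
∧-true {true}  {true}  _  = refl , refl
∧-true {true}  {false} ()
∧-true {false}         ()

not-true : ∀ {x} → not x ≡ true → x ≡ false
not-true {false} _ = refl

∣p∣≡∑ : ∀ {m} (p : Subset m) → ∣ p ∣ ≡ ∑[ x < m ] 𝟙 (lookup p x)
∣p∣≡∑ []          = refl
∣p∣≡∑ (true ∷ p)  = cong suc (∣p∣≡∑ p)
∣p∣≡∑ (false ∷ p) = ∣p∣≡∑ p

-- Hamiltonian paths and the weights w

Successor : ∀ {n} → Fin n → Fin n → Set
Successor i j = toℕ j ≡ suc (toℕ i)

successor-closure : ∀ {n} (R : Fin n → Fin n → Set) → (∀ {i j k} → R i j → R j k → R i k) →
                    (∀ i j → Successor i j → R i j) → ∀ i j → toℕ i < toℕ j → R i j
successor-closure {n} R R-trans R-step i j i<j = go (toℕ j ∸ suc (toℕ i)) j gap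
  where
  gap : toℕ j ≡ suc (toℕ j ∸ suc (toℕ i) + toℕ i)
  gap = sym (trans (sym (+-suc _ (toℕ i))) (m∸n+n≡m i<j))
  go : ∀ k j → toℕ j ≡ suc (k + toℕ i) → R i j
  go zero    j j≡ = R-step i j j≡
  go (suc k) j j≡ = R-trans (go k j′ (toℕ-fromℕ< j′<n))
                            (R-step j′ j (trans j≡ (cong suc (sym (toℕ-fromℕ< j′<n)))))
    where
    j′<n : suc (k + toℕ i) < n
    j′<n = ≤-trans (≤-reflexive (sym j≡)) (<⇒≤ (toℕ<n j))
    j′ : Fin n
    j′ = fromℕ< j′<n

wGo-≥ : ∀ {n} m (d : Fin n → ℕ) i → d i ≤ wGo m d i
wGo-≥ m d zero    = m≤n⊔m m (d zero)
wGo-≥ m d (suc i) = wGo-≥ _ (d ∘ suc) i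

wGo-step : ∀ {n} m (d : Fin n → ℕ) i j → Successor i j → wGo m d i < wGo m d j
wGo-step m d zero    (suc zero) j≡ = m≤m⊔n _ (d (suc zero))
wGo-step m d (suc i) (suc j)    j≡ = wGo-step _ (d ∘ suc) i j (suc-injective j≡)

wGo-least : ∀ {n} m (d s : Fin (suc n) → ℕ) → m ≤ s zero → (∀ i → d i ≤ s i) →
            (∀ i j → Successor i j → s i < s j) → ∀ i → wGo m d i ≤ s i
wGo-least m d s m≤s d≤s s-step zero = ⊔-lub m≤s (d≤s zero)
wGo-least {suc n} m d s m≤s d≤s s-step (suc i) =
  wGo-least _ (d ∘ suc) (s ∘ suc) (≤-trans (s≤s (⊔-lub m≤s (d≤s zero))) (s-step zero (suc zero) refl))
            (d≤s ∘ suc) (λ i j j≡ → s-step (suc i) (suc j) (cong suc j≡)) i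

wGo₀-least : ∀ {n} (d s : Fin n → ℕ) → (∀ i → d i ≤ s i) →
             (∀ i j → Successor i j → s i < s j) → ∀ i → wGo 0 d i ≤ s i
wGo₀-least {suc n} d s = wGo-least 0 d s z≤n

_++ʷ_ : ∀ {n} {A : Digraph n} {u v t} → Walk A u v → Walk A v t → Walk A u t
arc uv    ++ʷ q = cons uv q
cons uv p ++ʷ q = cons uv (p ++ʷ q)

module HamiltonianPath {n : ℕ} (A : Digraph n) (π : Permutation′ n) (ham : IsHamPath A π) where

  pos : Fin n → Fin n
  pos v = π ⟨$⟩ˡ v

  IncreasingAlong : (Fin n → ℕ) → Set
  IncreasingAlong s = ∀ i j → Successor i j → s (π ⟨$⟩ʳ i) < s (π ⟨$⟩ʳ j)

  at-pos : (s : Fin n → ℕ) (v : Fin n) → s (π ⟨$⟩ʳ pos v) ≡ s v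
  at-pos s v = cong s (inverseʳ π)

  increasing⇒< : ∀ {s} → IncreasingAlong s → ∀ {u v} → toℕ (pos u) < toℕ (pos v) → s u < s v
  increasing⇒< {s} s-inc {u} {v} u<v =
    subst₂ _<_ (at-pos s u) (at-pos s v) (successor-closure _ <-trans s-inc (pos u) (pos v) u<v)

  pos-injective : ∀ {u v} → toℕ (pos u) ≡ toℕ (pos v) → u ≡ v
  pos-injective {u} {v} u≡v =
    trans (sym (inverseʳ π)) (trans (cong (π ⟨$⟩ʳ_) (toℕ-injective u≡v)) (inverseʳ π))

  increasing⇒distinct : ∀ {s} → IncreasingAlong s → ∀ {u v} → u ≢ v → s u < s v ⊎ s v < s u
  increasing⇒distinct s-inc {u} {v} u≢v with <-cmp (toℕ (pos u)) (toℕ (pos v))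
  ... | tri< u<v _ _ = inj₁ (increasing⇒< s-inc u<v)
  ... | tri≈ _ u≡v _ = ⊥-elim (u≢v (pos-injective u≡v))
  ... | tri> _ _ v<u = inj₂ (increasing⇒< s-inc v<u)

  arc-forward : IsDAG A → ∀ {u v} → A u v ≡ true → toℕ (pos u) < toℕ (pos v)
  arc-forward dag {u} {v} uv with <-cmp (toℕ (pos u)) (toℕ (pos v))
  ... | tri< u<v _ _ = u<v
  ... | tri≈ _ u≡v _ = ⊥-elim (dag v (arc (subst (λ t → A t v ≡ true) (pos-injective u≡v) uv)))
  ... | tri> _ _ v<u = ⊥-elim (dag u (cons uv (subst₂ (Walk A) (inverseʳ π) (inverseʳ π) path)))
    where
    path : Walk A (π ⟨$⟩ʳ pos v) (π ⟨$⟩ʳ pos u)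
    path = successor-closure (λ i j → Walk A (π ⟨$⟩ʳ i) (π ⟨$⟩ʳ j)) _++ʷ_ (λ i j j≡ → arc (ham i j j≡)) _ _ v<u

  w-increasing : IncreasingAlong (w A π)
  w-increasing i j j≡ = subst₂ _<_ (sym (cong (wIdx A π) (inverseˡ π))) (sym (cong (wIdx A π) (inverseˡ π)))
                                  (wGo-step 0 _ i j j≡)

  w-arc : IsDAG A → ∀ {u v} → A u v ≡ true → w A π u < w A π v
  w-arc dag uv = increasing⇒< w-increasing (arc-forward dag uv)

  deg≤w : ∀ v → deg A v ≤ w A π v
  deg≤w v = subst (λ u → deg A u ≤ w A π v) (inverseʳ π) (wGo-≥ 0 _ (pos v))

  w-least : ∀ s → (∀ v → deg A v ≤ s v) → IncreasingAlong s → ∀ v → w A π v ≤ s v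
  w-least s deg≤s s-inc v = subst (w A π v ≤_) (at-pos s v)
    (wGo₀-least (deg A ∘ (π ⟨$⟩ʳ_)) (s ∘ (π ⟨$⟩ʳ_)) (λ _ → deg≤s _) s-inc (pos v))

-- DAGs and bipartite digraphs

TriangleFree : ∀ {n} → Digraph n → Set
TriangleFree A = ∀ u v t → Adj A u v ≡ true → Adj A v t ≡ true → Adj A u t ≡ true → ⊥

module Graph {n : ℕ} (A : Digraph n) where

  dag-irreflexive : IsDAG A → ∀ v → A v v ≡ false
  dag-irreflexive dag v with A v v in vv
  ... | true  = ⊥-elim (dag v (arc vv))
  ... | false = refl

  dag-asymmetric : IsDAG A → ∀ {u v} → A u v ≡ true → A v u ≡ false
  dag-asymmetric dag {u} {v} uv with A v u in vu
  ... | true  = ⊥-elim (dag u (cons uv (arc vu)))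
  ... | false = refl

  arc⇒≢ : IsDAG A → ∀ {u v} → A u v ≡ true → u ≢ v
  arc⇒≢ dag {u} uv refl = dag u (arc uv)

  arc⇒adj : ∀ {u v} → A u v ≡ true → Adj A u v ≡ true
  arc⇒adj {u} {v} uv = cong (_∨ A v u) uv

  adj-sym : ∀ {u v} → Adj A u v ≡ true → Adj A v u ≡ true
  adj-sym {u} {v} = trans (∨-comm (A v u) (A u v))

  adj⇒≢ : IsDAG A → ∀ {u v} → Adj A u v ≡ true → u ≢ v
  adj⇒≢ dag {u} uu refl with () ← trans (sym (cong (λ β → β ∨ β) (dag-irreflexive dag u))) uu

  colour : IsBipartite A → Fin n → Bool
  colour (X , _) = lookup X

  colour-false⇒∈Y : ((X , Y , _ , _ , X∪Y , _) : IsBipartite A) → ∀ {t} → lookup X t ≡ false → t ∈ Y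
  colour-false⇒∈Y (X , Y , _ , _ , X∪Y , _) {t} t∉X with X∪Y t
  ... | inj₁ t∈X with () ← trans (sym ([]=⇒lookup t∈X)) t∉X
  ... | inj₂ t∈Y = t∈Y

  adj⇒colour≢ : (bip : IsBipartite A) → ∀ {u v} → Adj A u v ≡ true → colour bip u ≢ colour bip v
  adj⇒colour≢ bip@(X , Y , X-ind , Y-ind , _) {u} {v} uv same with lookup X u in u∈X
  ... | true  with () ← trans (sym (X-ind u v (lookup⇒[]= u X u∈X) (lookup⇒[]= v X (sym same)))) uv
  ... | false with () ← trans (sym (Y-ind u v (colour-false⇒∈Y bip u∈X) (colour-false⇒∈Y bip (sym same)))) uv

  bipartite⇒triangle-free : IsBipartite A → TriangleFree A
  bipartite⇒triangle-free bip u v t uv vt ut =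
    adj⇒colour≢ bip ut (trans (¬-not (adj⇒colour≢ bip uv)) (sym (¬-not (adj⇒colour≢ bip (adj-sym vt)))))

IsClique : ∀ {n} → Digraph n → (Fin n → Bool) → Set
IsClique A K = ∀ u v → u ≢ v → K u ≡ true → K v ≡ true → Adj A u v ≡ true

OutsideArc : ∀ {n} → Digraph n → (Fin n → Bool) → Fin n → Fin n → Bool
OutsideArc A s u v = A u v ∧ (not (s u) ∧ not (s v))

-- Egerváry's theorem for b-matchings

Edge : ℕ → Set
Edge n = Fin n × Fin n

IsArc : ∀ {n} → Digraph n → Edge n → Set
IsArc A (u , v) = A u v ≡ true

ends : ∀ {n} → Edge n → Fin n → Bool
ends (p , q) t = does (p ≟ t) ∨ does (q ≟ t)

load : ∀ {n} → List (Edge n) → Fin n → ℕ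
load M t = sumˡ (map (λ e → 𝟙 (ends e t)) M)

Covers : ∀ {n} → (Fin n → Bool) → Edge n → Set
Covers C (p , q) = C p ∨ C q ≡ true

Crosses : ∀ {n} → (Fin n → Bool) → Edge n → Set
Crosses s (p , q) = s p ≢ s q

weightᶠ : ∀ {n} → (Fin n → ℕ) → (Fin n → Bool) → ℕ
weightᶠ {n} c C = ∑[ v < n ] (if C v then c v else 0)

insert : ∀ {n} → Fin n → (Fin n → Bool) → Fin n → Bool
insert t C v = does (t ≟ v) ∨ C v

module _ {n : ℕ} where

  ends-true : ∀ {p q t : Fin n} → ends (p , q) t ≡ true → t ≡ p ⊎ t ≡ q
  ends-true {p} {q} {t} pq∋t with p ≟ t | q ≟ t
  ... | yes refl | _        = inj₁ refl
  ... | no _     | yes refl = inj₂ refl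

  ∑-ends : ∀ {p q : Fin n} → p ≢ q → (f : Fin n → ℕ) →
           ∑[ t < n ] (if ends (p , q) t then f t else 0) ≡ f p + f q
  ∑-ends {p} {q} p≢q f = begin
    ∑[ t < n ] (if ends (p , q) t then f t else 0) ≡⟨ sum-cong-≗ split ⟩
    ∑[ t < n ] (at p t + at q t)                   ≡⟨ ∑-distrib-+ (at p) (at q) ⟩
    ∑[ t < n ] at p t + ∑[ t < n ] at q t          ≡⟨ cong₂ _+_ (∑-δ p f) (∑-δ q f) ⟩
    f p + f q                                      ∎
    where
    open ≡-Reasoning
    at : Fin n → Fin n → ℕ
    at r t = if does (r ≟ t) then f t else 0
    split : ∀ t → (if ends (p , q) t then f t else 0) ≡ at p t + at q t
    split t with p ≟ t | q ≟ t
    ... | yes refl | yes refl = ⊥-elim (p≢q refl)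
    ... | yes _    | no _     = sym (+-identityʳ (f t))
    ... | no _     | yes _    = refl
    ... | no _     | no _     = refl

  covers-mono : ∀ {C D : Fin n → Bool} → (∀ v → C v ≡ true → D v ≡ true) → ∀ {e} → Covers C e → Covers D e
  covers-mono {C} {D} C⊆D {p , q} Cpq with C p in Cp | C q in Cq
  ... | true  | _    = cong (_∨ D q) (C⊆D p Cp)
  ... | false | true = trans (cong (D p ∨_) (C⊆D q Cq)) (∨-zeroʳ (D p))

  ends-∋ˡ : ∀ (p q : Fin n) → ends (p , q) p ≡ true
  ends-∋ˡ p q = cong (_∨ does (q ≟ p)) (dec-true (p ≟ p) refl)

  ends-∋ʳ : ∀ (p q : Fin n) → ends (p , q) q ≡ true
  ends-∋ʳ p q = trans (cong (does (p ≟ q) ∨_) (dec-true (q ≟ q) refl)) (∨-zeroʳ _)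

  insert-∋ : ∀ t (C : Fin n → Bool) → insert t C t ≡ true
  insert-∋ t C = cong (_∨ C t) (dec-true (t ≟ t) refl)

  insert-⊇ : ∀ t (C : Fin n → Bool) v → C v ≡ true → insert t C v ≡ true
  insert-⊇ t C v Cv = trans (cong (does (t ≟ v) ∨_) Cv) (∨-zeroʳ _)

  weight-insert : ∀ (c : Fin n → ℕ) t C → weightᶠ c (insert t C) ≤ weightᶠ c C + c t
  weight-insert c t C = begin
    weightᶠ c (insert t C)                                   ≤⟨ ∑-mono-≤ split ⟩
    ∑[ v < n ] ((if C v then c v else 0) + at v)             ≡⟨ ∑-distrib-+ (λ v → if C v then c v else 0) at ⟩
    weightᶠ c C + ∑[ v < n ] at v                            ≡⟨ cong (weightᶠ c C +_) (∑-δ t c) ⟩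
    weightᶠ c C + c t                                        ∎
    where
    open ≤-Reasoning
    at : Fin n → ℕ
    at v = if does (t ≟ v) then c v else 0
    split : ∀ v → (if insert t C v then c v else 0) ≤ (if C v then c v else 0) + at v
    split v with does (t ≟ v) | C v
    ... | true  | true  = m≤m+n (c v) (c v)
    ... | true  | false = ≤-refl
    ... | false | true  = m≤m+n (c v) 0
    ... | false | false = z≤n

  weight-ends : ∀ {p q : Fin n} → p ≢ q → (c : Fin n → ℕ) → (∀ t → 𝟙 (ends (p , q) t) ≤ c t) → ∀ C →
                weightᶠ c C ≡ weightᶠ (λ t → c t ∸ 𝟙 (ends (p , q) t)) C + (𝟙 (C p) + 𝟙 (C q))
  weight-ends {p} {q} p≢q c δ≤c C = begin
    weightᶠ c C                                          ≡⟨ sum-cong-≗ split ⟩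
    ∑[ t < n ] ((if C t then c t ∸ δ t else 0) + (if ends (p , q) t then 𝟙 (C t) else 0))
      ≡⟨ ∑-distrib-+ (λ t → if C t then c t ∸ δ t else 0) _ ⟩
    weightᶠ (λ t → c t ∸ δ t) C + ∑[ t < n ] (if ends (p , q) t then 𝟙 (C t) else 0)
      ≡⟨ cong (weightᶠ (λ t → c t ∸ δ t) C +_) (∑-ends p≢q (𝟙 ∘ C)) ⟩
    weightᶠ (λ t → c t ∸ δ t) C + (𝟙 (C p) + 𝟙 (C q))   ∎
    where
    open ≡-Reasoning
    δ : Fin n → ℕ
    δ t = 𝟙 (ends (p , q) t)
    split : ∀ t → (if C t then c t else 0) ≡ (if C t then c t ∸ δ t else 0) + (if ends (p , q) t then 𝟙 (C t) else 0)
    split t with C t | ends (p , q) t | δ≤c t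
    ... | true  | true  | 1≤ct = sym (m∸n+n≡m 1≤ct)
    ... | true  | false | _    = sym (+-identityʳ (c t))
    ... | false | true  | _    = refl
    ... | false | false | _    = refl

record MatchingCover {n : ℕ} (L : List (Edge n)) (c : Fin n → ℕ) : Set where
  field
    matching   : List (Edge n)
    matching⊆L : All (_∈ₗ L) matching
    load≤      : ∀ t → load matching t ≤ c t
    cover      : Fin n → Bool
    covers     : All (Covers cover) L
    weight≤    : weightᶠ c cover ≤ length matching

∧∨-covers : ∀ x₁ x₂ y₁ y₂ → x₁ ∨ x₂ ≡ true → y₁ ∨ y₂ ≡ true →
            (x₁ ∧ y₁) ∨ (x₂ ∨ y₂) ≡ true
∧∨-covers true  _     true  _     _  _  = refl
∧∨-covers true  true  false _     _  _  = refl
∧∨-covers true  false false true  _  _  = refl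
∧∨-covers false true  _     _     _  _  = refl
∧∨-covers false false _     _     () _

∨∧-covers : ∀ x₁ x₂ y₁ y₂ → x₁ ∨ x₂ ≡ true → y₁ ∨ y₂ ≡ true →
            (x₁ ∨ y₁) ∨ (x₂ ∧ y₂) ≡ true
∨∧-covers x₁ x₂ y₁ y₂ x y =
  trans (∨-comm (x₁ ∨ y₁) _) (∧∨-covers x₂ x₁ y₂ y₁ (trans (∨-comm x₂ x₁) x) (trans (∨-comm y₂ y₁) y))

a+b≤c+d∧c<b⇒a<d : ∀ a b c d → a + b ≤ c + d → c < b → a < d
a+b≤c+d∧c<b⇒a<d a b c d a+b≤c+d c<b = +-cancelʳ-≤ c (suc a) d (begin
  suc a + c ≡⟨ +-suc a c ⟨
  a + suc c ≤⟨ +-monoʳ-≤ a c<b ⟩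
  a + b     ≤⟨ a+b≤c+d ⟩
  c + d     ≡⟨ +-comm c d ⟩
  d + c     ∎)
  where
  open ≤-Reasoning

module Egervary {n : ℕ} (s : Fin n → Bool) where

  _⊓_ _⊔_ : (Fin n → Bool) → (Fin n → Bool) → Fin n → Bool
  (C ⊓ D) t = if s t then C t ∧ D t else C t ∨ D t
  (C ⊔ D) t = if s t then C t ∨ D t else C t ∧ D t

  uncross-covers : ∀ C D {e} → Crosses s e × Covers C e × Covers D e → Covers (C ⊓ D) e × Covers (C ⊔ D) e
  uncross-covers C D {p , q} (p≁q , Cpq , Dpq) with s p | s q
  ... | true  | true  = ⊥-elim (p≁q refl)
  ... | true  | false = ∧∨-covers (C p) (C q) (D p) (D q) Cpq Dpq , ∨∧-covers (C p) (C q) (D p) (D q) Cpq Dpq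
  ... | false | true  = ∨∧-covers (C p) (C q) (D p) (D q) Cpq Dpq , ∧∨-covers (C p) (C q) (D p) (D q) Cpq Dpq
  ... | false | false = ⊥-elim (p≁q refl)

  uncross-covers-ends : ∀ C D {p q} → Crosses s (p , q) → D p ≡ true → D q ≡ true →
                        Covers (C ⊓ D) (p , q) × Covers (C ⊔ D) (p , q)
  uncross-covers-ends C D {p} {q} p≁q Dp Dq with s p | s q | D p | D q
  ... | true  | true  | _    | _    = ⊥-elim (p≁q refl)
  ... | true  | false | true | true = trans (cong ((C p ∧ true) ∨_) (∨-zeroʳ (C q))) (∨-zeroʳ _) ,
                                      cong (_∨ (C q ∧ true)) (∨-zeroʳ (C p))
  ... | false | true  | true | true = cong (_∨ (C q ∧ true)) (∨-zeroʳ (C p)) ,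
                                      trans (cong ((C p ∧ true) ∨_) (∨-zeroʳ (C q))) (∨-zeroʳ _)
  ... | false | false | _    | _    = ⊥-elim (p≁q refl)

  uncross-weight : ∀ c C D → weightᶠ c (C ⊓ D) + weightᶠ c (C ⊔ D) ≡ weightᶠ c C + weightᶠ c D
  uncross-weight c C D = begin
    weightᶠ c (C ⊓ D) + weightᶠ c (C ⊔ D) ≡⟨ ∑-distrib-+ (at (C ⊓ D)) (at (C ⊔ D)) ⟨
    ∑[ t < n ] (at (C ⊓ D) t + at (C ⊔ D) t) ≡⟨ sum-cong-≗ (λ t → split (s t) (C t) (D t) (c t)) ⟩
    ∑[ t < n ] (at C t + at D t)             ≡⟨ ∑-distrib-+ (at C) (at D) ⟩
    weightᶠ c C + weightᶠ c D ∎
    where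
    open ≡-Reasoning
    at : (Fin n → Bool) → Fin n → ℕ
    at X t = if X t then c t else 0
    split : ∀ a x y k → (if (if a then x ∧ y else x ∨ y) then k else 0) + (if (if a then x ∨ y else x ∧ y) then k else 0)
                        ≡ (if x then k else 0) + (if y then k else 0)
    split true  true  false k = sym (+-identityʳ k)
    split false false true  k = +-identityʳ k
    split true  true  true  k = refl
    split true  false y     k = refl
    split false true  y     k = refl
    split false false false k = refl

  -- Induction on the edges and, for a new edge pq, on c p. If c p or c q is 0, that end joins
  -- the cover; otherwise pq joins a matching for c lowered by one at p and q. If the cover of
  -- the latter contains both p and q, uncrossing it with the cover for the shorter list keeps
  -- the total weight, so one of the two uncrossed covers fits one of the two matchings.
  egervary : (L : List (Edge n)) → All (Crosses s) L → ∀ c → MatchingCover L c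
  egervary [] [] c = record
    { matching = [] ; matching⊆L = [] ; load≤ = λ _ → z≤n
    ; cover = λ _ → false ; covers = [] ; weight≤ = ≤-reflexive (sum-replicate-zero n) }
  egervary ((p , q) ∷ L) (p≁q ∷ L-crosses) c = extend (c p) c refl
    where
    e : Edge n
    e = p , q

    p≢q : p ≢ q
    p≢q refl = p≁q refl

    add : ∀ c t → c t ≡ 0 → (∀ C → Covers (insert t C) e) → MatchingCover (e ∷ L) c
    add c t ct≡0 insert-covers = record
      { matching = matching ; matching⊆L = All.map there matching⊆L ; load≤ = load≤
      ; cover = insert t cover
      ; covers = insert-covers cover ∷ All.map (covers-mono (insert-⊇ t cover)) covers
      ; weight≤ = begin
          weightᶠ c (insert t cover) ≤⟨ weight-insert c t cover ⟩
          weightᶠ c cover + c t      ≡⟨ cong (weightᶠ c cover +_) ct≡0 ⟩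
          weightᶠ c cover + 0        ≡⟨ +-identityʳ _ ⟩
          weightᶠ c cover            ≤⟨ weight≤ ⟩
          length matching            ∎ }
      where
      open MatchingCover (egervary L L-crosses c)
      open ≤-Reasoning

    augment : ∀ c → (∀ t → 𝟙 (ends e t) ≤ c t) →
              MatchingCover (e ∷ L) (λ t → c t ∸ 𝟙 (ends e t)) → MatchingCover (e ∷ L) c
    augment c δ≤c R″ = by-ends (cover p) (cover q) refl refl
      where
      open MatchingCover R″
      M⁺ : List (Edge n)
      M⁺ = e ∷ matching

      load⁺ : ∀ t → load M⁺ t ≤ c t
      load⁺ t = ≤-trans (+-monoʳ-≤ (𝟙 (ends e t)) (load≤ t)) (≤-reflexive (m+[n∸m]≡n (δ≤c t)))

      weight⁺ : weightᶠ c cover ≤ length matching + (𝟙 (cover p) + 𝟙 (cover q))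
      weight⁺ = ≤-trans (≤-reflexive (weight-ends p≢q c δ≤c cover)) (+-monoˡ-≤ _ weight≤)

      one-end : 𝟙 (cover p) + 𝟙 (cover q) ≤ 1 → MatchingCover (e ∷ L) c
      one-end ≤1 = record
        { matching = M⁺ ; matching⊆L = here refl ∷ matching⊆L ; load≤ = load⁺
        ; cover = cover ; covers = covers
        ; weight≤ = ≤-trans weight⁺ (≤-trans (+-monoʳ-≤ _ ≤1) (≤-reflexive (+-comm _ 1))) }

      both-ends : cover p ≡ true → cover q ≡ true → MatchingCover (e ∷ L) c
      both-ends Cp Cq = pick (weightᶠ c (cover′ ⊔ cover) ≤? length matching′)
        where
        open MatchingCover (egervary L L-crosses c) using () renaming
          (matching to matching′; matching⊆L to matching′⊆L; load≤ to load′≤; cover to cover′;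
           covers to covers′; weight≤ to weight′≤)
        L-uncrossed : All (Covers (cover′ ⊓ cover)) L × All (Covers (cover′ ⊔ cover)) L
        L-uncrossed = All.unzipWith (uncross-covers cover′ cover) (All.zip (L-crosses , All.zip (covers′ , All.tail covers)))
        e-uncrossed : Covers (cover′ ⊓ cover) e × Covers (cover′ ⊔ cover) e
        e-uncrossed = uncross-covers-ends cover′ cover p≁q Cp Cq
        total : weightᶠ c (cover′ ⊓ cover) + weightᶠ c (cover′ ⊔ cover) ≤ length matching′ + suc (length M⁺)
        total = begin
          weightᶠ c (cover′ ⊓ cover) + weightᶠ c (cover′ ⊔ cover) ≡⟨ uncross-weight c cover′ cover ⟩
          weightᶠ c cover′ + weightᶠ c cover                       ≤⟨ +-mono-≤ weight′≤ weight⁺ ⟩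
          length matching′ + (length matching + (𝟙 (cover p) + 𝟙 (cover q)))
            ≡⟨ cong (λ k → length matching′ + (length matching + k)) (cong₂ (λ x y → 𝟙 x + 𝟙 y) Cp Cq) ⟩
          length matching′ + (length matching + 2)                 ≡⟨ cong (length matching′ +_) (+-comm _ 2) ⟩
          length matching′ + suc (length M⁺)                       ∎
          where
          open ≤-Reasoning
        pick : Dec (weightᶠ c (cover′ ⊔ cover) ≤ length matching′) → MatchingCover (e ∷ L) c
        pick (yes ≤matching′) = record
          { matching = matching′ ; matching⊆L = All.map there matching′⊆L ; load≤ = load′≤
          ; cover = cover′ ⊔ cover ; covers = proj₂ e-uncrossed ∷ proj₂ L-uncrossed ; weight≤ = ≤matching′ }
        pick (no ≰matching′) = record
          { matching = M⁺ ; matching⊆L = here refl ∷ matching⊆L ; load≤ = load⁺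
          ; cover = cover′ ⊓ cover ; covers = proj₁ e-uncrossed ∷ proj₁ L-uncrossed
          ; weight≤ = s≤s⁻¹ (a+b≤c+d∧c<b⇒a<d _ _ _ _ total (≰⇒> ≰matching′)) }

      by-ends : ∀ x y → cover p ≡ x → cover q ≡ y → MatchingCover (e ∷ L) c
      by-ends true  true  Cp Cq = both-ends Cp Cq
      by-ends true  false Cp Cq = one-end (≤-reflexive (cong₂ (λ x y → 𝟙 x + 𝟙 y) Cp Cq))
      by-ends false true  Cp Cq = one-end (≤-reflexive (cong₂ (λ x y → 𝟙 x + 𝟙 y) Cp Cq))
      by-ends false false Cp Cq with () ← trans (sym (cong₂ _∨_ Cp Cq)) (All.head covers)

    extend : ∀ k c → c p ≡ k → MatchingCover (e ∷ L) c
    extend zero c cp≡0 = add c p cp≡0 (λ C → cong (_∨ insert p C q) (insert-∋ p C))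
    extend (suc k) c cp≡ with c q in cq≡
    ... | zero  = add c q cq≡ (λ C → trans (cong (insert q C p ∨_) (insert-∋ q C)) (∨-zeroʳ _))
    ... | suc _ = augment c δ≤c (extend k (λ t → c t ∸ 𝟙 (ends e t)) c′p≡k)
      where
      c′p≡k : c p ∸ 𝟙 (ends e p) ≡ k
      c′p≡k = trans (cong (λ β → c p ∸ 𝟙 β) (ends-∋ˡ p q)) (cong (_∸ 1) cp≡)
      δ≤c : ∀ t → 𝟙 (ends e t) ≤ c t
      δ≤c t with ends e t in e∋t
      ... | false = z≤n
      ... | true with ends-true {p = p} {q} {t} e∋t
      ...   | inj₁ refl = subst (1 ≤_) (sym cp≡) (s≤s z≤n)
      ...   | inj₂ refl = subst (1 ≤_) (sym cq≡) (s≤s z≤n)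

-- Representations given by lists of elements

occurrences : ∀ {n} → List (Fin n → Bool) → Fin n → ℕ
occurrences E v = sumˡ (map (λ h → 𝟙 (h v)) E)

Shares : ∀ {n} → Fin n → Fin n → (Fin n → Bool) → Set
Shares u v h = h u ≡ true × h v ≡ true

represent : ∀ {n} (E : List (Fin n → Bool)) → Fin n → Subset (length E)
represent E v = Vec.tabulate (λ x → List.lookup E x v)

module _ {n : ℕ} (E : List (Fin n → Bool)) where

  ∈-represent⁻ : ∀ {x v} → x ∈ represent E v → List.lookup E x v ≡ true
  ∈-represent⁻ {x} x∈ = trans (sym (lookup∘tabulate _ x)) ([]=⇒lookup x∈)

  ∈-represent⁺ : ∀ {x v} → List.lookup E x v ≡ true → x ∈ represent E v
  ∈-represent⁺ {x} Ex∋v = lookup⇒[]= x _ (trans (lookup∘tabulate _ x) Ex∋v)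

  represent-shares : ∀ {u v} → Any (Shares u v) E → ∃[ x ] x ∈ represent E u × x ∈ represent E v
  represent-shares shares = let (u∈ , v∈) = lookup-index shares in
    Any.index shares , ∈-represent⁺ u∈ , ∈-represent⁺ v∈

∣represent∣ : ∀ {n} (E : List (Fin n → Bool)) v → ∣ represent E v ∣ ≡ occurrences E v
∣represent∣ []      v = refl
∣represent∣ (h ∷ E) v with h v
... | true  = cong suc (∣represent∣ E v)
... | false = ∣represent∣ E v

represent-isDIR : ∀ {n} (A : Digraph n) (E : List (Fin n → Bool)) →
                  (∀ u v → A u v ≡ true → Any (Shares u v) E) → All (IsClique A) E →
                  (∀ u v → A u v ≡ true → ∣ represent E u ∣ < ∣ represent E v ∣) →
                  IsDIR A (length E) (represent E)
represent-isDIR A E arc-shares cliques grows u v =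
  (λ uv → represent-shares E (arc-shares u v uv) , grows u v uv) , backward
  where
  backward : (∃[ x ] x ∈ represent E u × x ∈ represent E v) × ∣ represent E u ∣ < ∣ represent E v ∣ → A u v ≡ true
  backward ((x , x∈u , x∈v) , u<v) with A u v in uv
  ... | true  = refl
  ... | false with A v u in vu
  ...   | true  = ⊥-elim (<-asym u<v (grows v u vu))
  ...   | false with () ← trans (sym (cong₂ _∨_ uv vu))
                          (All.lookup cliques (∈-lookup x) u v (λ { refl → <-irrefl refl u<v })
                                      (∈-represent⁻ E x∈u) (∈-represent⁻ E x∈v))

module _ {n : ℕ} where

  occurrences-++ : ∀ (E F : List (Fin n → Bool)) v → occurrences (E ++ F) v ≡ occurrences E v + occurrences F v
  occurrences-++ E F v = trans (cong sumˡ (map-++ _ E F)) (sum-++ (map _ E) _)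

  occurrences-replicate : ∀ k (h : Fin n → Bool) v → occurrences (List.replicate k h) v ≡ (if h v then k else 0)
  occurrences-replicate zero    h v with h v
  ... | true  = refl
  ... | false = refl
  occurrences-replicate (suc k) h v with h v | occurrences-replicate k h v
  ... | true  | IH = cong suc IH
  ... | false | IH = IH

  occurrences-map-ends : ∀ (M : List (Edge n)) v → occurrences (map ends M) v ≡ load M v
  occurrences-map-ends M v = cong sumˡ (sym (map-∘ M))

  ∑-load : (M : List (Edge n)) → All (λ (p , q) → p ≢ q) M → ∑[ t < n ] load M t ≡ length M + length M
  ∑-load []            []          = sum-replicate-zero n
  ∑-load ((p , q) ∷ M) (p≢q ∷ M≢) = begin
    ∑[ t < n ] (𝟙 (ends (p , q) t) + load M t)        ≡⟨ ∑-distrib-+ (λ t → 𝟙 (ends (p , q) t)) (load M) ⟩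
    ∑[ t < n ] 𝟙 (ends (p , q) t) + ∑[ t < n ] load M t ≡⟨ cong₂ _+_ (∑-ends p≢q (λ _ → 1)) (∑-load M M≢) ⟩
    2 + (length M + length M)                          ≡⟨ cong suc (+-suc (length M) (length M)) ⟨
    suc (length M) + suc (length M)                    ∎
    where
    open ≡-Reasoning

singleton : ∀ {n} → Fin n → Fin n → Bool
singleton t v = does (v ≟ t)

singletons : ∀ {n} → (Fin n → ℕ) → List (Fin n → Bool)
singletons {n} k = List.concatMap (λ t → List.replicate (k t) (singleton t)) (allFin n)

module _ {n : ℕ} (k : Fin n → ℕ) where

  occurrences-singletons : ∀ v → occurrences (singletons k) v ≡ k v
  occurrences-singletons v = begin
    occurrences (singletons k) v                                ≡⟨ go (allFin n) ⟩
    sumˡ (map (λ t → if singleton t v then k t else 0) (allFin n))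
      ≡⟨ list-sum-allFin (λ t → if singleton t v then k t else 0) ⟩
    ∑[ t < n ] (if does (v ≟ t) then k t else 0)                ≡⟨ ∑-δ v k ⟩
    k v                                                         ∎
    where
    open ≡-Reasoning
    go : ∀ ts → occurrences (List.concatMap (λ t → List.replicate (k t) (singleton t)) ts) v ≡
                sumˡ (map (λ t → if singleton t v then k t else 0) ts)
    go []       = refl
    go (t ∷ ts) = trans (occurrences-++ (List.replicate (k t) (singleton t)) _ v)
                        (cong₂ _+_ (occurrences-replicate (k t) (singleton t) v) (go ts))

  length-singletons : length (singletons k) ≡ sum k
  length-singletons = trans (go (allFin n)) (list-sum-allFin k)
    where
    go : ∀ ts → length (List.concatMap (λ t → List.replicate (k t) (singleton t)) ts) ≡ sumˡ (map k ts)
    go []       = refl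
    go (t ∷ ts) = trans (length-++ (List.replicate (k t) (singleton t)))
                        (cong₂ _+_ (length-replicate (k t)) (go ts))

  singletons-cliques : ∀ (A : Digraph n) → All (IsClique A) (singletons k)
  singletons-cliques A =
    concat⁺ (map⁺ (All.tabulate {xs = allFin n} λ {t} _ → replicate⁺ (k t) (singleton-clique t)))
    where
    singleton-clique : ∀ t → IsClique A (singleton t)
    singleton-clique t u v u≢v u∈ v∈ with u ≟ t | v ≟ t
    ... | yes refl | yes refl = ⊥-elim (u≢v refl)

-- The list of arcs

arc? : ∀ {n} (A : Digraph n) e → Dec (IsArc A e)
arc? A (u , v) = A u v Bool.≟ true

allEdges : ∀ n → List (Edge n)
allEdges n = cartesianProduct (allFin n) (allFin n)

arcs : ∀ {n} → Digraph n → List (Edge n)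
arcs {n} A = List.filter (arc? A) (allEdges n)

length≡sum-1 : ∀ {X : Set} (xs : List X) → length xs ≡ sumˡ (map (λ _ → 1) xs)
length≡sum-1 []       = refl
length≡sum-1 (_ ∷ xs) = cong suc (length≡sum-1 xs)

sum-map-cartesianProduct : ∀ {X Y : Set} (f : X × Y → ℕ) xs ys →
  sumˡ (map f (cartesianProduct xs ys)) ≡ sumˡ (map (λ x → sumˡ (map (λ y → f (x , y)) ys)) xs)
sum-map-cartesianProduct f []       ys = refl
sum-map-cartesianProduct f (x ∷ xs) ys = begin
  sumˡ (map f (map (x ,_) ys ++ cartesianProduct xs ys))
    ≡⟨ cong sumˡ (map-++ f (map (x ,_) ys) _) ⟩
  sumˡ (map f (map (x ,_) ys) ++ map f (cartesianProduct xs ys))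
    ≡⟨ sum-++ (map f (map (x ,_) ys)) _ ⟩
  sumˡ (map f (map (x ,_) ys)) + sumˡ (map f (cartesianProduct xs ys))
    ≡⟨ cong₂ _+_ (cong sumˡ (sym (map-∘ ys))) (sum-map-cartesianProduct f xs ys) ⟩
  sumˡ (map (λ y → f (x , y)) ys) + sumˡ (map (λ x → sumˡ (map (λ y → f (x , y)) ys)) xs) ∎
  where
  open ≡-Reasoning

sum-map-filter : ∀ {X : Set} {P : X → Set} (P? : ∀ x → Dec (P x)) (f : X → ℕ) xs →
  sumˡ (map f (List.filter P? xs)) ≡ sumˡ (map (λ x → if does (P? x) then f x else 0) xs)
sum-map-filter P? f []       = refl
sum-map-filter P? f (x ∷ xs) with does (P? x)
... | true  = cong (f x +_) (sum-map-filter P? f xs)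
... | false = sum-map-filter P? f xs

module _ {n : ℕ} (A : Digraph n) where

  open Graph A

  arcs-sound : All (IsArc A) (arcs A)
  arcs-sound = all-filter (arc? A) (allEdges n)

  ∈-arcs : ∀ {u v} → A u v ≡ true → (u , v) ∈ₗ arcs A
  ∈-arcs {u} {v} uv = ∈-filter⁺ _ (∈-cartesianProduct⁺ (∈-allFin u) (∈-allFin v)) uv

  sum-arcs : ∀ (f : Edge n → ℕ) → sumˡ (map f (arcs A)) ≡ ∑[ u < n ] ∑[ v < n ] (if A u v then f (u , v) else 0)
  sum-arcs f = begin
    sumˡ (map f (arcs A))
      ≡⟨ sum-map-filter (arc? A) f (allEdges n) ⟩
    sumˡ (map (λ (u , v) → row u v) (allEdges n))
      ≡⟨ sum-map-cartesianProduct _ (allFin n) (allFin n) ⟩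
    sumˡ (map (λ u → sumˡ (map (row u) (allFin n))) (allFin n))
      ≡⟨ list-sum-allFin (λ u → sumˡ (map (row u) (allFin n))) ⟩
    ∑[ u < n ] sumˡ (map (row u) (allFin n))
      ≡⟨ sum-cong-≗ (λ u → trans (list-sum-allFin (row u)) (sum-cong-≗ (λ v → if-≟-true (A u v)))) ⟩
    ∑[ u < n ] ∑[ v < n ] (if A u v then f (u , v) else 0) ∎
    where
    open ≡-Reasoning
    row : Fin n → Fin n → ℕ
    row u v = if does (A u v Bool.≟ true) then f (u , v) else 0
    if-≟-true : ∀ {k} β → (if does (β Bool.≟ true) then k else 0) ≡ (if β then k else 0)
    if-≟-true true  = refl
    if-≟-true false = refl

  numArcs≡∑² : numArcs A ≡ ∑[ u < n ] ∑[ v < n ] 𝟙 (A u v)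
  numArcs≡∑² = trans (list-sum-allFin (λ u → count (A u))) (sum-cong-≗ λ u → list-sum-allFin (λ v → 𝟙 (A u v)))

  numArcs≡length : numArcs A ≡ length (arcs A)
  numArcs≡length = begin
    numArcs A                       ≡⟨ numArcs≡∑² ⟩
    ∑[ u < n ] ∑[ v < n ] 𝟙 (A u v) ≡⟨ sum-arcs (λ _ → 1) ⟨
    sumˡ (map (λ _ → 1) (arcs A))   ≡⟨ length≡sum-1 (arcs A) ⟨
    length (arcs A)                 ∎
    where
    open ≡-Reasoning

  deg≡in+out : IsDAG A → ∀ t → deg A t ≡ ∑[ u < n ] 𝟙 (A u t) + ∑[ v < n ] 𝟙 (A t v)
  deg≡in+out dag t = begin
    deg A t                                   ≡⟨ list-sum-allFin (λ u → 𝟙 (A u t ∨ A t u)) ⟩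
    ∑[ u < n ] 𝟙 (A u t ∨ A t u)              ≡⟨ sum-cong-≗ split ⟩
    ∑[ u < n ] (𝟙 (A u t) + 𝟙 (A t u))        ≡⟨ ∑-distrib-+ (λ u → 𝟙 (A u t)) (λ u → 𝟙 (A t u)) ⟩
    ∑[ u < n ] 𝟙 (A u t) + ∑[ v < n ] 𝟙 (A t v) ∎
    where
    open ≡-Reasoning
    split : ∀ u → 𝟙 (A u t ∨ A t u) ≡ 𝟙 (A u t) + 𝟙 (A t u)
    split u with A u t in ut
    ... | true  = cong (λ β → 1 + 𝟙 β) (sym (dag-asymmetric dag ut))
    ... | false = refl

  load-arcs : IsDAG A → ∀ t → load (arcs A) t ≡ deg A t
  load-arcs dag t = begin
    load (arcs A) t
      ≡⟨ sum-arcs (λ e → 𝟙 (ends e t)) ⟩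
    ∑[ u < n ] ∑[ v < n ] (if A u v then 𝟙 (ends (u , v) t) else 0)
      ≡⟨ sum-cong-≗ (λ u → sum-cong-≗ (split u)) ⟩
    ∑[ u < n ] ∑[ v < n ] (from-t u v + to-t u v)
      ≡⟨ ∑²-distrib-+ from-t to-t ⟩
    ∑[ u < n ] ∑[ v < n ] from-t u v + ∑[ u < n ] ∑[ v < n ] to-t u v
      ≡⟨ cong₂ _+_ (trans (sum-cong-≗ λ u → ∑-if (does (u ≟ t)) (λ v → 𝟙 (A u v)))
                          (∑-δ′ t (λ u → ∑[ v < n ] 𝟙 (A u v))))
                   (sum-cong-≗ λ u → ∑-δ′ t (λ v → 𝟙 (A u v))) ⟩
    ∑[ v < n ] 𝟙 (A t v) + ∑[ u < n ] 𝟙 (A u t)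
      ≡⟨ +-comm (∑[ v < n ] 𝟙 (A t v)) _ ⟩
    ∑[ u < n ] 𝟙 (A u t) + ∑[ v < n ] 𝟙 (A t v)
      ≡⟨ deg≡in+out dag t ⟨
    deg A t ∎
    where
    open ≡-Reasoning
    from-t to-t : Fin n → Fin n → ℕ
    from-t u v = if does (u ≟ t) then 𝟙 (A u v) else 0
    to-t   u v = if does (v ≟ t) then 𝟙 (A u v) else 0
    split : ∀ u v → (if A u v then 𝟙 (ends (u , v) t) else 0) ≡ from-t u v + to-t u v
    split u v with A u v in uv | u ≟ t | v ≟ t
    ... | true  | yes refl | yes refl with () ← trans (sym (dag-irreflexive dag u)) uv
    ... | true  | yes _    | no _     = refl
    ... | true  | no _     | yes _    = refl
    ... | true  | no _     | no _     = refl
    ... | false | yes _    | yes _    = refl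
    ... | false | yes _    | no _     = refl
    ... | false | no _     | yes _    = refl
    ... | false | no _     | no _     = refl

  numArcs-split : IsDAG A → (s : Fin n → Bool) → (∀ u v → s u ≡ true → s v ≡ true → Adj A u v ≡ false) →
                  numArcs A ≡ ∑[ v < n ] (if s v then deg A v else 0) + ∑[ u < n ] ∑[ v < n ] 𝟙 (OutsideArc A s u v)
  numArcs-split dag s s-independent = begin
    numArcs A
      ≡⟨ numArcs≡∑² ⟩
    ∑[ u < n ] ∑[ v < n ] 𝟙 (A u v)
      ≡⟨ sum-cong-≗ (λ u → sum-cong-≗ (split u)) ⟩
    ∑[ u < n ] ∑[ v < n ] (into u v + (from u v + outside u v))
      ≡⟨ trans (∑²-distrib-+ into _) (cong (∑[ u < n ] ∑[ v < n ] into u v +_) (∑²-distrib-+ from outside)) ⟩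
    ∑[ u < n ] ∑[ v < n ] into u v + (∑[ u < n ] ∑[ v < n ] from u v + Z)
      ≡⟨ +-assoc (∑[ u < n ] ∑[ v < n ] into u v) _ Z ⟨
    ∑[ u < n ] ∑[ v < n ] into u v + ∑[ u < n ] ∑[ v < n ] from u v + Z
      ≡⟨ cong (_+ Z) S-degrees ⟨
    ∑[ v < n ] (if s v then deg A v else 0) + Z ∎
    where
    open ≡-Reasoning
    into from outside : Fin n → Fin n → ℕ
    into    u v = if s v then 𝟙 (A u v) else 0
    from    u v = if s u then 𝟙 (A u v) else 0
    outside u v = 𝟙 (OutsideArc A s u v)
    Z : ℕ
    Z = ∑[ u < n ] ∑[ v < n ] outside u v
    split : ∀ u v → 𝟙 (A u v) ≡ into u v + (from u v + outside u v)
    split u v with A u v in uv | s u in su | s v in sv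
    ... | true  | true  | true  with () ← trans (sym (s-independent u v su sv)) (arc⇒adj uv)
    ... | true  | true  | false = refl
    ... | true  | false | true  = refl
    ... | true  | false | false = refl
    ... | false | true  | true  = refl
    ... | false | true  | false = refl
    ... | false | false | true  = refl
    ... | false | false | false = refl
    S-degrees : ∑[ v < n ] (if s v then deg A v else 0) ≡ ∑[ u < n ] ∑[ v < n ] into u v + ∑[ u < n ] ∑[ v < n ] from u v
    S-degrees = begin
      ∑[ v < n ] (if s v then deg A v else 0)
        ≡⟨ sum-cong-≗ (λ v → trans (cong (λ d → if s v then d else 0) (deg≡in+out dag v)) (if-+ (s v))) ⟩
      ∑[ v < n ] ((if s v then ∑[ u < n ] 𝟙 (A u v) else 0) + (if s v then ∑[ u < n ] 𝟙 (A v u) else 0))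
        ≡⟨ ∑-distrib-+ (λ v → if s v then ∑[ u < n ] 𝟙 (A u v) else 0) _ ⟩
      ∑[ v < n ] (if s v then ∑[ u < n ] 𝟙 (A u v) else 0) + ∑[ u < n ] (if s u then ∑[ v < n ] 𝟙 (A u v) else 0)
        ≡⟨ cong₂ _+_ (trans (sum-cong-≗ λ v → sym (∑-if (s v) (λ u → 𝟙 (A u v)))) (∑-comm (λ v u → into u v)))
                     (sum-cong-≗ λ u → sym (∑-if (s u) (λ v → 𝟙 (A u v)))) ⟩
      ∑[ u < n ] ∑[ v < n ] into u v + ∑[ u < n ] ∑[ v < n ] from u v ∎

  arc-clique : ∀ {e} → IsArc A e → IsClique A (ends e)
  arc-clique {p , q} pq u v u≢v u∈ v∈ with ends-true {p = p} {q} {u} u∈ | ends-true {p = p} {q} {v} v∈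
  ... | inj₁ refl | inj₁ refl = ⊥-elim (u≢v refl)
  ... | inj₁ refl | inj₂ refl = arc⇒adj pq
  ... | inj₂ refl | inj₁ refl = adj-sym (arc⇒adj pq)
  ... | inj₂ refl | inj₂ refl = ⊥-elim (u≢v refl)

-- A representation of size |A| + α(D, b)

uncovered : ∀ {n} → (Fin n → Bool) → Subset n
uncovered C = Vec.tabulate (not ∘ C)

module _ {n : ℕ} where

  lookup-uncovered : ∀ (C : Fin n → Bool) v → lookup (uncovered C) v ≡ not (C v)
  lookup-uncovered C = lookup∘tabulate (not ∘ C)

  weight≡weightᶠ : ∀ (c : Fin n → ℕ) S → weight c S ≡ weightᶠ c (lookup S)
  weight≡weightᶠ c S = list-sum-allFin (λ v → if lookup S v then c v else 0)

  weight-uncovered : ∀ (c : Fin n → ℕ) C → weightᶠ c C + weight c (uncovered C) ≡ sum c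
  weight-uncovered c C = begin
    weightᶠ c C + weight c (uncovered C)
      ≡⟨ cong (weightᶠ c C +_) (trans (weight≡weightᶠ c (uncovered C))
                                       (sum-cong-≗ λ v → cong (λ β → if β then c v else 0) (lookup-uncovered C v))) ⟩
    weightᶠ c C + weightᶠ c (not ∘ C)  ≡⟨ ∑-distrib-+ (λ v → if C v then c v else 0) _ ⟨
    ∑[ v < n ] ((if C v then c v else 0) + (if not (C v) then c v else 0)) ≡⟨ sum-cong-≗ split ⟩
    sum c ∎
    where
    open ≡-Reasoning
    split : ∀ v → (if C v then c v else 0) + (if not (C v) then c v else 0) ≡ c v
    split v with C v
    ... | true  = +-identityʳ (c v)
    ... | false = refl

  ∈-uncovered⁻ : ∀ {C : Fin n → Bool} {x} → x ∈ uncovered C → C x ≡ false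
  ∈-uncovered⁻ {C} {x} x∈ = Bool.not-injective (trans (sym (lookup-uncovered C x)) ([]=⇒lookup x∈))

  uncovered-independent : ∀ (A : Digraph n) C → All (Covers C) (arcs A) → IsIndependent A (uncovered C)
  uncovered-independent A C covers u v u∈ v∈ with A u v in uv | A v u in vu
  ... | true  | _    with () ← trans (sym (cong₂ _∨_ (∈-uncovered⁻ u∈) (∈-uncovered⁻ v∈))) (All.lookup covers (∈-arcs A uv))
  ... | false | true with () ← trans (sym (cong₂ _∨_ (∈-uncovered⁻ v∈) (∈-uncovered⁻ u∈))) (All.lookup covers (∈-arcs A vu))
  ... | false | false = refl

module UpperBound {n : ℕ} (A : Digraph n) (dag : IsDAG A) (bip : IsBipartite A)
                  (π : Permutation′ n) (ham : IsHamPath A π) where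

  open HamiltonianPath A π ham
  open Graph A
  open Egervary (colour bip)

  arcs-cross : All (Crosses (colour bip)) (arcs A)
  arcs-cross = All.map (adj⇒colour≢ bip ∘ arc⇒adj) (arcs-sound A)

  open MatchingCover (egervary (arcs A) arcs-cross (b A π))

  S : Subset n
  S = uncovered cover

  S-independent : IsIndependent A S
  S-independent = uncovered-independent A cover covers

  a : ℕ
  a = weight (b A π) S

  spare : Fin n → ℕ
  spare t = b A π t ∸ load matching t

  matching+spare≤a : length matching + sum spare ≤ a
  matching+spare≤a = +-cancelʳ-≤ (length matching) _ _ (begin
    length matching + sum spare + length matching   ≡⟨ cong (_+ length matching) (+-comm (length matching) (sum spare)) ⟩
    sum spare + length matching + length matching   ≡⟨ +-assoc (sum spare) _ _ ⟩
    sum spare + (length matching + length matching) ≡⟨ cong (sum spare +_) (∑-load matching matching-loopless) ⟨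
    sum spare + sum (load matching)                 ≡⟨ ∑-distrib-+ spare (load matching) ⟨
    ∑[ t < n ] (spare t + load matching t)          ≡⟨ sum-cong-≗ (λ t → m∸n+n≡m (load≤ t)) ⟩
    sum (b A π)                                     ≡⟨ weight-uncovered (b A π) cover ⟨
    weightᶠ (b A π) cover + a                       ≤⟨ +-monoˡ-≤ a weight≤ ⟩
    length matching + a                             ≡⟨ +-comm (length matching) a ⟩
    a + length matching                             ∎)
    where
    open ≤-Reasoning
    matching-loopless : All (λ (p , q) → p ≢ q) matching
    matching-loopless = All.map (λ e∈ → arc⇒≢ dag (All.lookup (arcs-sound A) e∈)) matching⊆L

  pad : ℕ
  pad = a ∸ (length matching + sum spare)

  arc-elements matching-elements private-elements unused-elements elements : List (Fin n → Bool)
  arc-elements      = map ends (arcs A)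
  matching-elements = map ends matching
  private-elements  = singletons spare
  unused-elements   = List.replicate pad (λ _ → false)
  elements          = arc-elements ++ matching-elements ++ private-elements ++ unused-elements

  occurrences-elements : ∀ v → occurrences elements v ≡ w A π v
  occurrences-elements v = begin
    occurrences elements v
      ≡⟨ occurrences-++ arc-elements _ v ⟩
    occurrences arc-elements v + occurrences (matching-elements ++ private-elements ++ unused-elements) v
      ≡⟨ cong (occurrences arc-elements v +_) (occurrences-++ matching-elements _ v) ⟩
    occurrences arc-elements v + (occurrences matching-elements v + occurrences (private-elements ++ unused-elements) v)
      ≡⟨ cong (λ k → occurrences arc-elements v + (occurrences matching-elements v + k)) private+unused ⟩
    occurrences arc-elements v + (occurrences matching-elements v + spare v)
      ≡⟨ cong₂ (λ x y → x + (y + spare v)) (occurrences-map-ends (arcs A) v) (occurrences-map-ends matching v) ⟩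
    load (arcs A) v + (load matching v + spare v)
      ≡⟨ cong₂ _+_ (load-arcs A dag v) (m+[n∸m]≡n (load≤ v)) ⟩
    deg A v + b A π v
      ≡⟨ m+[n∸m]≡n (deg≤w v) ⟩
    w A π v ∎
    where
    open ≡-Reasoning
    private+unused : occurrences (private-elements ++ unused-elements) v ≡ spare v
    private+unused = begin
      occurrences (private-elements ++ unused-elements) v           ≡⟨ occurrences-++ private-elements _ v ⟩
      occurrences private-elements v + occurrences unused-elements v ≡⟨ cong₂ _+_ (occurrences-singletons spare v)
                                                                                   (occurrences-replicate pad _ v) ⟩
      spare v + 0                                                   ≡⟨ +-identityʳ (spare v) ⟩
      spare v                                                       ∎

  length-elements : length elements ≡ numArcs A + a
  length-elements = begin
    length elements
      ≡⟨ length-++ arc-elements ⟩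
    length arc-elements + length (matching-elements ++ private-elements ++ unused-elements)
      ≡⟨ cong (length arc-elements +_) (trans (length-++ matching-elements) (cong (length matching-elements +_)
                                                                              (length-++ private-elements))) ⟩
    length arc-elements + (length matching-elements + (length private-elements + length unused-elements))
      ≡⟨ cong₂ (λ x y → x + (y + (length private-elements + length unused-elements)))
               (trans (length-map ends (arcs A)) (sym (numArcs≡length A))) (length-map ends matching) ⟩
    numArcs A + (length matching + (length private-elements + length unused-elements))
      ≡⟨ cong₂ (λ x y → numArcs A + (length matching + (x + y))) (length-singletons spare) (length-replicate pad) ⟩
    numArcs A + (length matching + (sum spare + pad))
      ≡⟨ cong (numArcs A +_) (trans (sym (+-assoc (length matching) (sum spare) pad)) (m+[n∸m]≡n matching+spare≤a)) ⟩
    numArcs A + a ∎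
    where
    open ≡-Reasoning

  size≡w : ∀ v → ∣ represent elements v ∣ ≡ w A π v
  size≡w v = trans (∣represent∣ elements v) (occurrences-elements v)

  elements-isDIR : IsDIR A (length elements) (represent elements)
  elements-isDIR = represent-isDIR A elements arc-shares cliques grows
    where
    arc-shares : ∀ u v → A u v ≡ true → Any (Shares u v) elements
    arc-shares u v uv = ++⁺ˡ (Any.map⁺ (Any.map (λ { refl → ends-∋ˡ u v , ends-∋ʳ u v }) (∈-arcs A uv)))
    cliques : All (IsClique A) elements
    cliques = ++⁺ (map⁺ (All.map (arc-clique A) (arcs-sound A)))
             (++⁺ (map⁺ (All.map (arc-clique A ∘ All.lookup (arcs-sound A)) matching⊆L))
             (++⁺ (singletons-cliques spare A)
                  (replicate⁺ pad λ _ _ _ ())))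
    grows : ∀ u v → A u v ≡ true → ∣ represent elements u ∣ < ∣ represent elements v ∣
    grows u v uv = subst₂ _<_ (sym (size≡w u)) (sym (size≡w v)) (w-arc dag uv)

  representation : Σ (Fin n → Subset (numArcs A + a)) (IsDIR A (numArcs A + a))
  representation = subst (λ k → Σ (Fin n → Subset k) (IsDIR A k)) length-elements
                         (represent elements , elements-isDIR)

-- Every representation has size at least |A| + α(D, b)

module CliqueCount {n : ℕ} (A : Digraph n) (dag : IsDAG A) (tf : TriangleFree A)
                   {K : Fin n → Bool} (K-clique : IsClique A K) where

  open Graph A

  no-three : ∀ {a b c} → K a ≡ true → K b ≡ true → K c ≡ true → a ≢ b → b ≢ c → a ≢ c → ⊥
  no-three Ka Kb Kc a≢b b≢c a≢c =
    tf _ _ _ (K-clique _ _ a≢b Ka Kb) (K-clique _ _ b≢c Kb Kc) (K-clique _ _ a≢c Ka Kc)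

  in-pair : ∀ {u v t} → K u ≡ true → K v ≡ true → u ≢ v → K t ≡ true → t ≡ u ⊎ t ≡ v
  in-pair {u} {v} {t} Ku Kv u≢v Kt with t ≟ u | t ≟ v
  ... | yes t≡u | _       = inj₁ t≡u
  ... | no _    | yes t≡v = inj₂ t≡v
  ... | no t≢u  | no t≢v  = ⊥-elim (no-three Kt Ku Kv t≢u u≢v t≢v)

  neighbours≤1 : ∀ {v} → K v ≡ true → ∑[ u < n ] 𝟙 (K u ∧ Adj A u v) ≤ 1
  neighbours≤1 {v} Kv = ∑𝟙≤1 (λ u → K u ∧ Adj A u v) unique
    where
    unique : ∀ i j → K i ∧ Adj A i v ≡ true → K j ∧ Adj A j v ≡ true → i ≡ j
    unique i j hi hj with i ≟ j | ∧-true hi | ∧-true hj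
    ... | yes i≡j | _ | _ = i≡j
    ... | no i≢j | Ki , iv | Kj , jv = ⊥-elim (no-three Ki Kj Kv i≢j (adj⇒≢ dag jv) (adj⇒≢ dag iv))

  module _ (s : Fin n → Bool) (s-independent : ∀ u v → s u ≡ true → s v ≡ true → Adj A u v ≡ false) where

    unpack : ∀ {u v} → OutsideArc A s u v ∧ (K u ∧ K v) ≡ true →
             A u v ≡ true × s u ≡ false × s v ≡ false × K u ≡ true × K v ≡ true
    unpack h =
      let (arc-out , Kuv) = ∧-true h ; (uv , out) = ∧-true arc-out
          (su , sv) = ∧-true out ; (Ku , Kv) = ∧-true Kuv
      in uv , not-true su , not-true sv , Ku , Kv

    clique-usage≤1 : ∑[ v < n ] 𝟙 (s v ∧ K v) + ∑[ u < n ] ∑[ v < n ] 𝟙 (OutsideArc A s u v ∧ (K u ∧ K v)) ≤ 1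
    clique-usage≤1 with any? (λ v → s v ∧ K v Bool.≟ true)
    ... | yes (v₀ , h₀) =
      ≤-trans (+-mono-≤ (∑𝟙≤1 _ unique-in-s) (≤-reflexive no-outside-arc)) (≤-reflexive (+-identityʳ 1))
      where
      unique-in-s : ∀ i j → s i ∧ K i ≡ true → s j ∧ K j ≡ true → i ≡ j
      unique-in-s i j hi hj with i ≟ j | ∧-true hi | ∧-true hj
      ... | yes i≡j | _ | _ = i≡j
      ... | no i≢j | si , Ki | sj , Kj with () ← trans (sym (s-independent i j si sj)) (K-clique i j i≢j Ki Kj)
      no-outside-arc : ∑[ u < n ] ∑[ v < n ] 𝟙 (OutsideArc A s u v ∧ (K u ∧ K v)) ≡ 0
      no-outside-arc = ∑-zero _ λ u → ∑-zero (λ v → 𝟙 (OutsideArc A s u v ∧ (K u ∧ K v))) λ v → 𝟙-false λ h →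
        let (uv , su , sv , Ku , Kv) = unpack h ; (s₀ , K₀) = ∧-true h₀ in
        [ (λ { refl → case trans (sym su) s₀ of λ () }) , (λ { refl → case trans (sym sv) s₀ of λ () }) ]′
          (in-pair Ku Kv (arc⇒≢ dag uv) K₀)
    ... | no none = ≤-trans (+-mono-≤ (≤-reflexive nothing-in-s) (∑∑𝟙≤1 _ unique-arc)) ≤-refl
      where
      nothing-in-s : ∑[ v < n ] 𝟙 (s v ∧ K v) ≡ 0
      nothing-in-s = ∑-zero _ λ v → 𝟙-false λ h → none (v , h)
      unique-arc : ∀ {u v u′ v′} → OutsideArc A s u v ∧ (K u ∧ K v) ≡ true →
                   OutsideArc A s u′ v′ ∧ (K u′ ∧ K v′) ≡ true → u ≡ u′ × v ≡ v′
      unique-arc h h′ with unpack h | unpack h′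
      ... | uv , _ , _ , Ku , Kv | uv′ , _ , _ , Ku′ , Kv′
        with in-pair Ku Kv (arc⇒≢ dag uv) Ku′ | in-pair Ku Kv (arc⇒≢ dag uv) Kv′
      ... | inj₁ refl | inj₁ refl = ⊥-elim (arc⇒≢ dag uv′ refl)
      ... | inj₁ refl | inj₂ refl = refl , refl
      ... | inj₂ refl | inj₁ refl with () ← trans (sym (dag-asymmetric dag uv)) uv′
      ... | inj₂ refl | inj₂ refl = ⊥-elim (arc⇒≢ dag uv′ refl)

module LowerBound {n : ℕ} (A : Digraph n) (dag : IsDAG A) (bip : IsBipartite A)
                  (π : Permutation′ n) (ham : IsHamPath A π)
                  {m : ℕ} (φ : Fin n → Subset m) (dir : IsDIR A m φ) where

  open HamiltonianPath A π ham
  open Graph A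

  holds : Fin m → Fin n → Bool
  holds x v = lookup (φ v) x

  size : Fin n → ℕ
  size v = ∣ φ v ∣

  size-increasing : IncreasingAlong size
  size-increasing i j j≡ = proj₂ (proj₁ (dir _ _) (ham i j j≡))

  arc-shares : ∀ {u v} → A u v ≡ true → ∃[ x ] holds x u ≡ true × holds x v ≡ true
  arc-shares {u} {v} uv = let (x , x∈u , x∈v) = proj₁ (proj₁ (dir u v) uv) in x , []=⇒lookup x∈u , []=⇒lookup x∈v

  adj-shares : ∀ {u v} → Adj A u v ≡ true → ∃[ x ] holds x u ≡ true × holds x v ≡ true
  adj-shares {u} {v} uv with A u v in u→v
  ... | true  = arc-shares u→v
  ... | false = let (x , hv , hu) = arc-shares uv in x , hu , hv

  holders-clique : ∀ x → IsClique A (holds x)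
  holders-clique x u v u≢v hu hv with increasing⇒distinct size-increasing u≢v
  ... | inj₁ u<v = arc⇒adj (proj₂ (dir u v) ((x , lookup⇒[]= x (φ u) hu , lookup⇒[]= x (φ v) hv) , u<v))
  ... | inj₂ v<u = adj-sym (arc⇒adj (proj₂ (dir v u) ((x , lookup⇒[]= x (φ v) hv , lookup⇒[]= x (φ u) hu) , v<u)))

  open module Count x = CliqueCount A dag (bipartite⇒triangle-free bip) (holders-clique x)

  deg≤size : ∀ v → deg A v ≤ size v
  deg≤size v = begin
    deg A v                                                        ≡⟨ list-sum-allFin (λ u → 𝟙 (Adj A u v)) ⟩
    ∑[ u < n ] 𝟙 (Adj A u v)                                       ≤⟨ ∑-mono-≤ (λ u → 𝟙≤ (shared u)) ⟩
    ∑[ u < n ] ∑[ x < m ] 𝟙 (holds x v ∧ (holds x u ∧ Adj A u v))  ≡⟨ ∑-comm (λ u x → 𝟙 (holds x v ∧ (holds x u ∧ Adj A u v))) ⟩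
    ∑[ x < m ] ∑[ u < n ] 𝟙 (holds x v ∧ (holds x u ∧ Adj A u v))  ≤⟨ ∑-mono-≤ per-element ⟩
    ∑[ x < m ] 𝟙 (holds x v)                                       ≡⟨ ∣p∣≡∑ (φ v) ⟨
    size v                                                         ∎
    where
    open ≤-Reasoning
    shared : ∀ u → Adj A u v ≡ true → 1 ≤ ∑[ x < m ] 𝟙 (holds x v ∧ (holds x u ∧ Adj A u v))
    shared u uv = let (x , hu , hv) = adj-shares uv in
      witness≤∑ (λ x → holds x v ∧ (holds x u ∧ Adj A u v)) (trans (cong₂ (λ x y → x ∧ (y ∧ Adj A u v)) hv hu) uv)
    per-element : ∀ x → ∑[ u < n ] 𝟙 (holds x v ∧ (holds x u ∧ Adj A u v)) ≤ 𝟙 (holds x v)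
    per-element x with holds x v in hv
    ... | true  = neighbours≤1 x hv
    ... | false = ≤-reflexive (sum-replicate-zero n)

  deg+b≤size : ∀ v → deg A v + b A π v ≤ size v
  deg+b≤size v = ≤-trans (≤-reflexive (m+[n∸m]≡n (deg≤w v))) (w-least size deg≤size size-increasing v)

  module _ (S : Subset n) (S-independent : IsIndependent A S) where

    s : Fin n → Bool
    s = lookup S

    s-independent : ∀ u v → s u ≡ true → s v ≡ true → Adj A u v ≡ false
    s-independent u v su sv = S-independent u v (lookup⇒[]= u S su) (lookup⇒[]= v S sv)

    size-in-S : ∀ v → (if s v then size v else 0) ≡ ∑[ x < m ] 𝟙 (s v ∧ holds x v)
    size-in-S v with s v
    ... | true  = ∣p∣≡∑ (φ v)
    ... | false = sym (sum-replicate-zero m)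

    outside-shared : ∀ u v → 𝟙 (OutsideArc A s u v) ≤ ∑[ x < m ] 𝟙 (OutsideArc A s u v ∧ (holds x u ∧ holds x v))
    outside-shared u v = 𝟙≤ λ out → let (x , hu , hv) = arc-shares (proj₁ (∧-true out)) in
      witness≤∑ (λ x → OutsideArc A s u v ∧ (holds x u ∧ holds x v)) (cong₂ _∧_ out (cong₂ _∧_ hu hv))

    usage : Fin m → ℕ
    usage x = ∑[ v < n ] 𝟙 (s v ∧ holds x v) +
              ∑[ u < n ] ∑[ v < n ] 𝟙 (OutsideArc A s u v ∧ (holds x u ∧ holds x v))

    numArcs+weight≤m : numArcs A + weight (b A π) S ≤ m
    numArcs+weight≤m = begin
      numArcs A + weight (b A π) S
        ≡⟨ cong₂ _+_ (numArcs-split A dag s s-independent) (weight≡weightᶠ (b A π) S) ⟩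
      D + Z + W
        ≡⟨ xy∙z≈xz∙y D Z W ⟩
      D + W + Z
        ≡⟨ cong (_+ Z) (trans (sym (∑-distrib-+ (λ v → if s v then deg A v else 0) _))
                              (sum-cong-≗ λ v → sym (if-+ (s v)))) ⟩
      ∑[ v < n ] (if s v then deg A v + b A π v else 0) + Z
        ≤⟨ +-mono-≤ (∑-mono-≤ λ v → if-mono (s v) (deg+b≤size v))
                    (∑-mono-≤ λ u → ∑-mono-≤ (outside-shared u)) ⟩
      ∑[ v < n ] (if s v then size v else 0) + ∑[ u < n ] ∑[ v < n ] ∑[ x < m ] used-by-arc x u v
        ≡⟨ cong₂ _+_ (trans (sum-cong-≗ size-in-S) (∑-comm (λ v x → 𝟙 (s v ∧ holds x v))))
                     (trans (sum-cong-≗ λ u → ∑-comm (λ v x → used-by-arc x u v))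
                            (∑-comm (λ u x → ∑[ v < n ] used-by-arc x u v))) ⟩
      ∑[ x < m ] ∑[ v < n ] 𝟙 (s v ∧ holds x v) + ∑[ x < m ] ∑[ u < n ] ∑[ v < n ] used-by-arc x u v
        ≡⟨ ∑-distrib-+ (λ x → ∑[ v < n ] 𝟙 (s v ∧ holds x v)) (λ x → ∑[ u < n ] ∑[ v < n ] used-by-arc x u v) ⟨
      ∑[ x < m ] usage x
        ≤⟨ ∑-mono-≤ (λ x → clique-usage≤1 x s s-independent) ⟩
      ∑[ x < m ] 1
        ≡⟨ ∑-const-1 m ⟩
      m ∎
      where
      open ≤-Reasoning
      D W Z : ℕ
      D = ∑[ v < n ] (if s v then deg A v else 0)
      W = weightᶠ (b A π) s
      Z = ∑[ u < n ] ∑[ v < n ] 𝟙 (OutsideArc A s u v)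
      used-by-arc : Fin m → Fin n → Fin n → ℕ
      used-by-arc x u v = 𝟙 (OutsideArc A s u v ∧ (holds x u ∧ holds x v))

corollary17 : (n : ℕ) (A : Digraph n) → IsDAG A → IsBipartite A →
    (π : Permutation′ n) → IsHamPath A π →
    Σ ℕ λ a → IsAlpha A (b A π) a × IsDin A (numArcs A + a)
corollary17 n A dag bip π ham = a , ((S , S-independent , refl) , maximal) , representation , minimal
  where
  open UpperBound A dag bip π ham
  lower : ∀ {m} (φ : Fin n → Subset m) → IsDIR A m φ →
          ∀ S → IsIndependent A S → numArcs A + weight (b A π) S ≤ m
  lower = LowerBound.numArcs+weight≤m A dag bip π ham
  maximal : ∀ S′ → IsIndependent A S′ → weight (b A π) S′ ≤ a
  maximal S′ S′-independent =
    +-cancelˡ-≤ (numArcs A) _ _ (lower (proj₁ representation) (proj₂ representation) S′ S′-independent)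
  minimal : ∀ m (φ : Fin n → Subset m) → IsDIR A m φ → numArcs A + a ≤ m
  minimal m φ dir = lower φ dir S S-independent
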